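{- Let $n\ge2$ and $R_n(a,b,c)=9a^2+6(n-1)ab+(n-1)(n+7)b^2+4(n-1)(n-2)bc+(n-2)\binom{n-1}{2}c^2$. The only point $[a:b:c]\in\mathbb{RP}^2$ with $R_n(a,b,c)=0$ is the one with $a=k(n-1)\binom{n-1}{2}$, $b=-3k\binom{n-1}{2}$, $c=6k(n-1)$ for $k\in\mathbb R\setminus\{0\}$.
   Context: $a,b,c$ real; points of $\mathbb{RP}^2$ are nonzero real triples up to scaling. -}

module Defs where

open import Level using (0ℓ)
open import Data.Nat as ℕ using (ℕ; zero; suc; _∸_)
open import Data.Nat.Combinatorics using (_C_)
open import Data.Product using (Σ; ∃; _×_; _,_)
open import Data.Sum using (_⊎_)
open import Data.Empty using (⊥)
open import Relation.Nullary using (¬_)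
open import Relation.Binary.PropositionalEquality using (_≡_)
open import Relation.Binary.Structures using (IsStrictTotalOrder)
open import Algebra.Structures using (IsCommutativeRing)
open import Function.Bundles using (_⇔_)

-- Axiomatisation of the real numbers as a complete ordered field
-- (any model is isomorphic to ℝ).  Equality is propositional equality.
record RealField : Set₁ where
  infixl 7 _*_
  infixl 6 _+_
  infix 4 _<_ _≤_
  field
    ℝ   : Set
    _+_ : ℝ → ℝ → ℝ
    _*_ : ℝ → ℝ → ℝ
    -_  : ℝ → ℝ
    0ℝ  : ℝ
    1ℝ  : ℝ
    isCommutativeRing : IsCommutativeRing _≡_ _+_ _*_ -_ 0ℝ 1ℝ
    0≢1 : ¬ (0ℝ ≡ 1ℝ)
    inv : (x : ℝ) → ¬ (x ≡ 0ℝ) → ℝ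
    inv-inverse : (x : ℝ) (p : ¬ (x ≡ 0ℝ)) → x * inv x p ≡ 1ℝ
    _<_ : ℝ → ℝ → Set
    <-isStrictTotalOrder : IsStrictTotalOrder _≡_ _<_
    +-mono-< : ∀ {x y} z → x < y → x + z < y + z
    *-pos : ∀ {x y} → 0ℝ < x → 0ℝ < y → 0ℝ < x * y

  _≤_ : ℝ → ℝ → Set
  x ≤ y = x < y ⊎ x ≡ y

  field
    sup : (P : ℝ → Set) → (∃ λ x → P x) → (∃ λ u → ∀ x → P x → x ≤ u) →
          ∃ λ s → (∀ x → P x → x ≤ s) × (∀ u → (∀ x → P x → x ≤ u) → s ≤ u)

module _ (Rl : RealField) where
  open RealField Rl

  ι : ℕ → ℝ
  ι zero = 0ℝ
  ι (suc n) = 1ℝ + ι n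

  Rpoly : ℕ → ℝ → ℝ → ℝ → ℝ
  Rpoly n a b c =
      ι 9 * a * a
    + ι (6 ℕ.* (n ∸ 1)) * a * b
    + ι ((n ∸ 1) ℕ.* (n ℕ.+ 7)) * b * b
    + ι (4 ℕ.* (n ∸ 1) ℕ.* (n ∸ 2)) * b * c
    + ι ((n ∸ 2) ℕ.* ((n ∸ 1) C 2)) * c * c

  -- a nonzero real triple (representative of a point of ℝP²)
  NonzeroTriple : ℝ → ℝ → ℝ → Set
  NonzeroTriple a b c = ¬ (a ≡ 0ℝ × b ≡ 0ℝ × c ≡ 0ℝ)

  IsSpecialPoint : ℕ → ℝ → ℝ → ℝ → Set
  IsSpecialPoint n a b c = ∃ λ k → ¬ (k ≡ 0ℝ)
    × a ≡ k * ι ((n ∸ 1) ℕ.* ((n ∸ 1) C 2))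
    × b ≡ - (k * ι (3 ℕ.* ((n ∸ 1) C 2)))
    × c ≡ k * ι (6 ℕ.* (n ∸ 1))

-- With n = d + 2, m = n - 1 and q = C(n-1,2), so that 2q = m d, completing squares gives
--   2 R_n(a,b,c) = 2 (3a + m b)² + m (4b + d c)².
-- Both weights are positive, so R_n vanishes exactly where 3a + m b = 0 and 4b + d c = 0.
-- A nonzero solution has c ≠ 0, and writing c = 6 m k gives b = -3 q k and a = m q k.
module Submission where

open import Defs
open import Data.Nat using (ℕ; _≤_)
open import Relation.Binary.PropositionalEquality using (_≡_)
open import Function.Bundles using (_⇔_)

open import Level using (0ℓ)
open import Algebra.Bundles using (CommutativeRing)
open import Data.Nat as ℕ using (zero; suc; s≤s; z≤n)
open import Data.Nat.Combinatorics using (_C_; nCk+nC[k+1]≡[n+1]C[k+1]; nC1≡n)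
open import Data.Nat.Properties using (*-comm; *-distribˡ-+)
open import Data.Product using (_×_; _,_; ∃)
open import Data.Sum using (inj₁; inj₂)
open import Data.Empty using (⊥-elim)
open import Function.Base using (_∘_)
open import Function.Bundles using (mk⇔; module Equivalence)
open import Function.Properties.Equivalence using (⇔-setoid)
open import Relation.Nullary using (¬_)
open import Relation.Binary.Definitions using (tri<; tri≈; tri>)
open import Relation.Binary.Structures using (IsStrictTotalOrder)
open import Relation.Binary.PropositionalEquality
  using (refl; sym; trans; cong; cong₂; subst; subst₂; module ≡-Reasoning)

2*[1+m]C2≡[1+m]*m : ∀ m → 2 ℕ.* (suc m C 2) ≡ suc m ℕ.* m
2*[1+m]C2≡[1+m]*m zero    = refl
2*[1+m]C2≡[1+m]*m (suc m) = begin
  2 ℕ.* (suc (suc m) C 2)              ≡⟨ cong (2 ℕ.*_) (sym (nCk+nC[k+1]≡[n+1]C[k+1] (suc m) 1)) ⟩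
  2 ℕ.* (suc m C 1 ℕ.+ suc m C 2)      ≡⟨ cong (λ t → 2 ℕ.* (t ℕ.+ suc m C 2)) (nC1≡n (suc m)) ⟩
  2 ℕ.* (suc m ℕ.+ suc m C 2)          ≡⟨ *-distribˡ-+ 2 (suc m) (suc m C 2) ⟩
  2 ℕ.* suc m ℕ.+ 2 ℕ.* (suc m C 2)    ≡⟨ cong₂ ℕ._+_ (*-comm 2 (suc m)) (2*[1+m]C2≡[1+m]*m m) ⟩
  suc m ℕ.* 2 ℕ.+ suc m ℕ.* m          ≡⟨ *-distribˡ-+ (suc m) 2 m ⟨
  suc m ℕ.* suc (suc m)                ≡⟨ *-comm (suc m) (suc (suc m)) ⟩
  suc (suc m) ℕ.* suc m                ∎
  where open ≡-Reasoning

module Quadric (Rl : RealField) where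
  open RealField Rl renaming (_≤_ to _≤ℝ_)

  private
    commutativeRing : CommutativeRing 0ℓ 0ℓ
    commutativeRing = record { isCommutativeRing = isCommutativeRing }

  open CommutativeRing commutativeRing
    using (commutativeSemiring; semiring; ring; +-identityˡ; +-identityʳ; -‿inverseˡ; -‿inverseʳ;
           *-identityˡ; *-identityʳ; *-assoc; zeroˡ; zeroʳ)
    renaming (*-comm to *-commℝ; +-comm to +-commℝ)
  open import Algebra.Properties.Ring ring
    using (-‿involutive; -‿distribˡ-*; -‿distribʳ-*; +-inverseˡ-unique; -0#≈0#)
  open import Algebra.Properties.Semiring.Mult semiring
    using (×-homo-+; ×1-homo-*) renaming (_×_ to _×ᵤ_)
  open import Algebra.Solver.Ring.NaturalCoefficients.Default commutativeSemiring
    using (solve; _:=_; _:+_; _:*_; con; Polynomial)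
  open IsStrictTotalOrder <-isStrictTotalOrder using (compare; irrefl; asym) renaming (trans to <-trans)

  ι≡×1 : ∀ k → ι Rl k ≡ k ×ᵤ 1ℝ
  ι≡×1 zero    = refl
  ι≡×1 (suc k) = cong (1ℝ +_) (ι≡×1 k)

  ι-+ : ∀ m n → ι Rl (m ℕ.+ n) ≡ ι Rl m + ι Rl n
  ι-+ m n = begin
    ι Rl (m ℕ.+ n)            ≡⟨ ι≡×1 (m ℕ.+ n) ⟩
    (m ℕ.+ n) ×ᵤ 1ℝ           ≡⟨ ×-homo-+ 1ℝ m n ⟩
    m ×ᵤ 1ℝ + n ×ᵤ 1ℝ         ≡⟨ cong₂ _+_ (ι≡×1 m) (ι≡×1 n) ⟨
    ι Rl m + ι Rl n           ∎
    where open ≡-Reasoning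

  ι-* : ∀ m n → ι Rl (m ℕ.* n) ≡ ι Rl m * ι Rl n
  ι-* m n = begin
    ι Rl (m ℕ.* n)            ≡⟨ ι≡×1 (m ℕ.* n) ⟩
    (m ℕ.* n) ×ᵤ 1ℝ           ≡⟨ ×1-homo-* m n ⟩
    (m ×ᵤ 1ℝ) * (n ×ᵤ 1ℝ)     ≡⟨ cong₂ _*_ (ι≡×1 m) (ι≡×1 n) ⟨
    ι Rl m * ι Rl n           ∎
    where open ≡-Reasoning

  -- Its value is definitionally ι Rl k, so numerals of Rpoly can be written as they are in solver calls.
  ι̂ : ∀ {v} → ℕ → Polynomial v
  ι̂ zero    = con 0
  ι̂ (suc k) = con 1 :+ ι̂ k

  0<x⇒x≢0 : ∀ {x} → 0ℝ < x → ¬ (x ≡ 0ℝ)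
  0<x⇒x≢0 0<x x≡0 = irrefl (sym x≡0) 0<x

  x<0⇒0<-x : ∀ {x} → x < 0ℝ → 0ℝ < - x
  x<0⇒0<-x {x} x<0 = subst₂ _<_ (-‿inverseʳ x) (+-identityˡ (- x)) (+-mono-< (- x) x<0)

  -x*-x≡x*x : ∀ x → - x * - x ≡ x * x
  -x*-x≡x*x x = begin
    - x * - x          ≡⟨ -‿distribˡ-* x (- x) ⟨
    - (x * - x)        ≡⟨ cong -_ (-‿distribʳ-* x x) ⟨
    - - (x * x)        ≡⟨ -‿involutive (x * x) ⟩
    x * x              ∎
    where open ≡-Reasoning

  x≢0⇒0<x*x : ∀ {x} → ¬ (x ≡ 0ℝ) → 0ℝ < x * x
  x≢0⇒0<x*x {x} x≢0 with compare x 0ℝ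
  ... | tri< x<0 _ _ = subst (0ℝ <_) (-x*-x≡x*x x) (*-pos (x<0⇒0<-x x<0) (x<0⇒0<-x x<0))
  ... | tri≈ _ x≡0 _ = ⊥-elim (x≢0 x≡0)
  ... | tri> _ _ 0<x = *-pos 0<x 0<x

  0≤x*x : ∀ x → 0ℝ ≤ℝ x * x
  0≤x*x x with compare x 0ℝ
  ... | tri< _ x≢0 _ = inj₁ (x≢0⇒0<x*x x≢0)
  ... | tri≈ _ x≡0 _ = inj₂ (sym (trans (cong (_* x) x≡0) (zeroˡ x)))
  ... | tri> _ x≢0 _ = inj₁ (x≢0⇒0<x*x x≢0)

  x*x≡0⇒x≡0 : ∀ {x} → x * x ≡ 0ℝ → x ≡ 0ℝ
  x*x≡0⇒x≡0 {x} x*x≡0 with compare x 0ℝ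
  ... | tri≈ _ x≡0 _ = x≡0
  ... | tri< _ x≢0 _ = ⊥-elim (0<x⇒x≢0 (x≢0⇒0<x*x x≢0) x*x≡0)
  ... | tri> _ x≢0 _ = ⊥-elim (0<x⇒x≢0 (x≢0⇒0<x*x x≢0) x*x≡0)

  0<1 : 0ℝ < 1ℝ
  0<1 = subst (0ℝ <_) (*-identityˡ 1ℝ) (x≢0⇒0<x*x (0≢1 ∘ sym))

  0<ι[1+k] : ∀ k → 0ℝ < ι Rl (suc k)
  0<ι[1+k] zero    = subst (0ℝ <_) (sym (+-identityʳ 1ℝ)) 0<1
  0<ι[1+k] (suc k) =
    <-trans (0<ι[1+k] k) (subst (_< ι Rl (suc (suc k))) (+-identityˡ _) (+-mono-< (ι Rl (suc k)) 0<1))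

  ι[1+k]≢0 : ∀ k → ¬ (ι Rl (suc k) ≡ 0ℝ)
  ι[1+k]≢0 k = 0<x⇒x≢0 (0<ι[1+k] k)

  0<u⇒0≤x⇒0≤u*x : ∀ {u x} → 0ℝ < u → 0ℝ ≤ℝ x → 0ℝ ≤ℝ u * x
  0<u⇒0≤x⇒0≤u*x 0<u (inj₁ 0<x)     = inj₁ (*-pos 0<u 0<x)
  0<u⇒0≤x⇒0≤u*x {u} _ (inj₂ 0≡x) = inj₂ (sym (trans (cong (u *_) (sym 0≡x)) (zeroʳ u)))

  0≤x⇒0≤y⇒x+y≡0⇒x≡0 : ∀ {x y} → 0ℝ ≤ℝ x → 0ℝ ≤ℝ y → x + y ≡ 0ℝ → x ≡ 0ℝ
  0≤x⇒0≤y⇒x+y≡0⇒x≡0 (inj₂ 0≡x) _ _ = sym 0≡x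
  0≤x⇒0≤y⇒x+y≡0⇒x≡0 {x} {y} (inj₁ 0<x) 0≤y x+y≡0 = ⊥-elim (0≤y⇒y≮0 0≤y y<0)
    where
    y<0 : y < 0ℝ
    y<0 = subst₂ _<_ (+-identityˡ y) x+y≡0 (+-mono-< y 0<x)
    0≤y⇒y≮0 : 0ℝ ≤ℝ y → ¬ (y < 0ℝ)
    0≤y⇒y≮0 (inj₁ 0<y) = asym 0<y
    0≤y⇒y≮0 (inj₂ 0≡y) = irrefl (sym 0≡y)

  inv[k]*[k*x]≡x : ∀ {k} (k≢0 : ¬ (k ≡ 0ℝ)) x → inv k k≢0 * (k * x) ≡ x
  inv[k]*[k*x]≡x {k} k≢0 x = begin
    inv k k≢0 * (k * x)      ≡⟨ *-assoc (inv k k≢0) k x ⟨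
    inv k k≢0 * k * x        ≡⟨ cong (_* x) (trans (*-commℝ (inv k k≢0) k) (inv-inverse k k≢0)) ⟩
    1ℝ * x                   ≡⟨ *-identityˡ x ⟩
    x                        ∎
    where open ≡-Reasoning

  *-cancelˡ : ∀ {k x y} → ¬ (k ≡ 0ℝ) → k * x ≡ k * y → x ≡ y
  *-cancelˡ {k} {x} {y} k≢0 kx≡ky = begin
    x                        ≡⟨ inv[k]*[k*x]≡x k≢0 x ⟨
    inv k k≢0 * (k * x)      ≡⟨ cong (inv k k≢0 *_) kx≡ky ⟩
    inv k k≢0 * (k * y)      ≡⟨ inv[k]*[k*x]≡x k≢0 y ⟩
    y                        ∎
    where open ≡-Reasoning

  k*x≡0⇔x≡0 : ∀ {k x} → ¬ (k ≡ 0ℝ) → k * x ≡ 0ℝ ⇔ x ≡ 0ℝ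
  k*x≡0⇔x≡0 {k} {x} k≢0 = mk⇔
    (λ k*x≡0 → *-cancelˡ k≢0 (trans k*x≡0 (sym (zeroʳ k))))
    (λ x≡0 → trans (cong (k *_) x≡0) (zeroʳ k))

  y≡0⇒-[x*y]≡0 : ∀ {x y} → y ≡ 0ℝ → - (x * y) ≡ 0ℝ
  y≡0⇒-[x*y]≡0 {x} y≡0 = trans (cong (λ t → - (x * t)) y≡0) (trans (cong -_ (zeroʳ x)) -0#≈0#)

  x≡[x*inv[s]]*s : ∀ {s} (s≢0 : ¬ (s ≡ 0ℝ)) x → x ≡ x * inv s s≢0 * s
  x≡[x*inv[s]]*s {s} s≢0 x = begin
    x                        ≡⟨ *-identityʳ x ⟨
    x * 1ℝ                   ≡⟨ cong (x *_) (inv-inverse s s≢0) ⟨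
    x * (s * inv s s≢0)      ≡⟨ cong (x *_) (*-commℝ s (inv s s≢0)) ⟩
    x * (inv s s≢0 * s)      ≡⟨ *-assoc x (inv s s≢0) s ⟨
    x * inv s s≢0 * s        ∎
    where open ≡-Reasoning

  x+y≡0⇔x≡-y : ∀ {x y} → x + y ≡ 0ℝ ⇔ x ≡ - y
  x+y≡0⇔x≡-y {x} {y} = mk⇔ (+-inverseˡ-unique x y) (λ x≡-y → trans (cong (_+ y) x≡-y) (-‿inverseˡ y))

  u*x²+v*y²≡0⇔x≡0×y≡0 : ∀ {u v x y} → 0ℝ < u → 0ℝ < v →
    u * (x * x) + v * (y * y) ≡ 0ℝ ⇔ (x ≡ 0ℝ × y ≡ 0ℝ)
  u*x²+v*y²≡0⇔x≡0×y≡0 {u} {v} {x} {y} 0<u 0<v = mk⇔ vanishing (λ { (refl , refl) → zero-at-origin u v })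
    where
    0≤u*x² : 0ℝ ≤ℝ u * (x * x)
    0≤u*x² = 0<u⇒0≤x⇒0≤u*x 0<u (0≤x*x x)
    0≤v*y² : 0ℝ ≤ℝ v * (y * y)
    0≤v*y² = 0<u⇒0≤x⇒0≤u*x 0<v (0≤x*x y)
    zero-at-origin : ∀ u v → u * (0ℝ * 0ℝ) + v * (0ℝ * 0ℝ) ≡ 0ℝ
    zero-at-origin = solve 2 (λ u v → u :* (con 0 :* con 0) :+ v :* (con 0 :* con 0) := con 0) refl
    square-vanishes : ∀ {w z} → 0ℝ < w → w * (z * z) ≡ 0ℝ → z ≡ 0ℝ
    square-vanishes 0<w = x*x≡0⇒x≡0 ∘ Equivalence.to (k*x≡0⇔x≡0 (0<x⇒x≢0 0<w))
    vanishing : u * (x * x) + v * (y * y) ≡ 0ℝ → x ≡ 0ℝ × y ≡ 0ℝ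
    vanishing sum≡0 =
        square-vanishes 0<u (0≤x⇒0≤y⇒x+y≡0⇒x≡0 0≤u*x² 0≤v*y² sum≡0)
      , square-vanishes 0<v (0≤x⇒0≤y⇒x+y≡0⇒x≡0 0≤v*y² 0≤u*x² (trans (+-commℝ _ _) sum≡0))

  -- R_n with n - 2 and C(n-1,2) replaced by real parameters d and q; Rform₀ is its q-free part.
  Rform₀ : ℝ → ℝ → ℝ → ℝ → ℝ
  Rform₀ d a b c =
      ι Rl 9 * a * a
    + ι Rl 6 * (1ℝ + d) * a * b
    + (1ℝ + d) * (1ℝ + (1ℝ + d) + ι Rl 7) * b * b
    + ι Rl 4 * (1ℝ + d) * d * b * c

  Rform : ℝ → ℝ → ℝ → ℝ → ℝ → ℝ
  Rform d q a b c = Rform₀ d a b c + d * q * c * c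

  Rpoly≡Rform : ∀ p a b c → Rpoly Rl (suc (suc p)) a b c ≡ Rform (ι Rl p) (ι Rl (suc p C 2)) a b c
  Rpoly≡Rform p a b c = coefficients-≡
    refl
    (ι-* 6 (suc p))
    (trans (ι-* (suc p) (suc (suc p) ℕ.+ 7)) (cong (ι Rl (suc p) *_) (ι-+ (suc (suc p)) 7)))
    (trans (ι-* (4 ℕ.* suc p) p) (cong (_* ι Rl p) (ι-* 4 (suc p))))
    (ι-* p (suc p C 2))
    where
    coefficients-≡ : ∀ {c₁ c₂ c₃ c₄ c₅ c₁′ c₂′ c₃′ c₄′ c₅′} →
      c₁ ≡ c₁′ → c₂ ≡ c₂′ → c₃ ≡ c₃′ → c₄ ≡ c₄′ → c₅ ≡ c₅′ →
      c₁ * a * a + c₂ * a * b + c₃ * b * b + c₄ * b * c + c₅ * c * c ≡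
      c₁′ * a * a + c₂′ * a * b + c₃′ * b * b + c₄′ * b * c + c₅′ * c * c
    coefficients-≡ refl refl refl refl refl = refl

  ι2*ι[[1+p]C2]≡ι[1+p]*ι[p] : ∀ p → ι Rl 2 * ι Rl (suc p C 2) ≡ ι Rl (suc p) * ι Rl p
  ι2*ι[[1+p]C2]≡ι[1+p]*ι[p] p = begin
    ι Rl 2 * ι Rl (suc p C 2)       ≡⟨ ι-* 2 (suc p C 2) ⟨
    ι Rl (2 ℕ.* (suc p C 2))        ≡⟨ cong (ι Rl) (2*[1+m]C2≡[1+m]*m p) ⟩
    ι Rl (suc p ℕ.* p)              ≡⟨ ι-* (suc p) p ⟩
    ι Rl (suc p) * ι Rl p           ∎
    where open ≡-Reasoning

  X : ℝ → ℝ → ℝ → ℝ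
  X d a b = ι Rl 3 * a + (1ℝ + d) * b

  Y : ℝ → ℝ → ℝ → ℝ
  Y d b c = ι Rl 4 * b + d * c

  IsNonzeroMultiple : ℝ → ℝ → ℝ → ℝ → ℝ → ℝ → Set
  IsNonzeroMultiple α β γ a b c = ∃ λ k → ¬ (k ≡ 0ℝ) × a ≡ k * α × b ≡ - (k * β) × c ≡ k * γ

  IsNonzeroMultiple-cong : ∀ {α α′ β β′ γ γ′} → α ≡ α′ → β ≡ β′ → γ ≡ γ′ →
    ∀ a b c → IsNonzeroMultiple α β γ a b c ≡ IsNonzeroMultiple α′ β′ γ′ a b c
  IsNonzeroMultiple-cong refl refl refl a b c = refl

  IsSpecialPoint≡IsNonzeroMultiple : ∀ p a b c → IsSpecialPoint Rl (suc (suc p)) a b c ≡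
    IsNonzeroMultiple (ι Rl (suc p) * ι Rl (suc p C 2)) (ι Rl 3 * ι Rl (suc p C 2)) (ι Rl 6 * ι Rl (suc p)) a b c
  IsSpecialPoint≡IsNonzeroMultiple p =
    IsNonzeroMultiple-cong (ι-* (suc p) (suc p C 2)) (ι-* 3 (suc p C 2)) (ι-* 6 (suc p))

  module _ {d q : ℝ} (2q≡[1+d]d : ι Rl 2 * q ≡ (1ℝ + d) * d) where

    2Rform≡2X²+[1+d]Y² : ∀ a b c →
      ι Rl 2 * Rform d q a b c ≡ ι Rl 2 * (X d a b * X d a b) + (1ℝ + d) * (Y d b c * Y d b c)
    2Rform≡2X²+[1+d]Y² a b c = begin
      ι Rl 2 * Rform d q a b c
        ≡⟨ isolate-q (Rform₀ d a b c) d q c ⟩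
      ι Rl 2 * Rform₀ d a b c + d * c * c * (ι Rl 2 * q)
        ≡⟨ cong (λ t → ι Rl 2 * Rform₀ d a b c + d * c * c * t) 2q≡[1+d]d ⟩
      ι Rl 2 * Rform₀ d a b c + d * c * c * ((1ℝ + d) * d)
        ≡⟨ complete-squares a b c d ⟩
      ι Rl 2 * (X d a b * X d a b) + (1ℝ + d) * (Y d b c * Y d b c) ∎
      where
      open ≡-Reasoning
      isolate-q : ∀ r d q c → ι Rl 2 * (r + d * q * c * c) ≡ ι Rl 2 * r + d * c * c * (ι Rl 2 * q)
      isolate-q = solve 4 (λ r d q c → ι̂ 2 :* (r :+ d :* q :* c :* c) := ι̂ 2 :* r :+ d :* c :* c :* (ι̂ 2 :* q)) refl
      complete-squares : ∀ a b c d →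
        ι Rl 2 * Rform₀ d a b c + d * c * c * ((1ℝ + d) * d) ≡
        ι Rl 2 * (X d a b * X d a b) + (1ℝ + d) * (Y d b c * Y d b c)
      complete-squares = solve 4 (λ a b c d →
          ι̂ 2 :* (ι̂ 9 :* a :* a :+ ι̂ 6 :* (con 1 :+ d) :* a :* b
                  :+ (con 1 :+ d) :* (con 1 :+ (con 1 :+ d) :+ ι̂ 7) :* b :* b
                  :+ ι̂ 4 :* (con 1 :+ d) :* d :* b :* c)
            :+ d :* c :* c :* ((con 1 :+ d) :* d)
        := ι̂ 2 :* ((ι̂ 3 :* a :+ (con 1 :+ d) :* b) :* (ι̂ 3 :* a :+ (con 1 :+ d) :* b))
            :+ (con 1 :+ d) :* ((ι̂ 4 :* b :+ d :* c) :* (ι̂ 4 :* b :+ d :* c))) refl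

    X-at-multiple : ∀ k → X d (k * ((1ℝ + d) * q)) (- (k * (ι Rl 3 * q))) ≡ 0ℝ
    X-at-multiple k = begin
      ι Rl 3 * (k * ((1ℝ + d) * q)) + (1ℝ + d) * - (k * (ι Rl 3 * q))
        ≡⟨ cong₂ _+_ (reorder k q d) (sym (-‿distribʳ-* (1ℝ + d) (k * (ι Rl 3 * q)))) ⟩
      (1ℝ + d) * (k * (ι Rl 3 * q)) + - ((1ℝ + d) * (k * (ι Rl 3 * q)))
        ≡⟨ -‿inverseʳ _ ⟩
      0ℝ ∎
      where
      open ≡-Reasoning
      reorder : ∀ k q d → ι Rl 3 * (k * ((1ℝ + d) * q)) ≡ (1ℝ + d) * (k * (ι Rl 3 * q))
      reorder = solve 3 (λ k q d → ι̂ 3 :* (k :* ((con 1 :+ d) :* q)) := (con 1 :+ d) :* (k :* (ι̂ 3 :* q))) refl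

    Y-at-multiple : ∀ k → Y d (- (k * (ι Rl 3 * q))) (k * (ι Rl 6 * (1ℝ + d))) ≡ 0ℝ
    Y-at-multiple k = begin
      ι Rl 4 * - (k * (ι Rl 3 * q)) + d * (k * (ι Rl 6 * (1ℝ + d)))
        ≡⟨ cong₂ _+_ (sym (-‿distribʳ-* (ι Rl 4) (k * (ι Rl 3 * q)))) d*k*6[1+d]≡4*k*3q ⟩
      - (ι Rl 4 * (k * (ι Rl 3 * q))) + ι Rl 4 * (k * (ι Rl 3 * q))
        ≡⟨ -‿inverseˡ _ ⟩
      0ℝ ∎
      where
      open ≡-Reasoning
      d*k*6[1+d]≡4*k*3q : d * (k * (ι Rl 6 * (1ℝ + d))) ≡ ι Rl 4 * (k * (ι Rl 3 * q))
      d*k*6[1+d]≡4*k*3q = begin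
        d * (k * (ι Rl 6 * (1ℝ + d)))   ≡⟨ solve 2 (λ d k → d :* (k :* (ι̂ 6 :* (con 1 :+ d))) := ι̂ 6 :* k :* ((con 1 :+ d) :* d)) refl d k ⟩
        ι Rl 6 * k * ((1ℝ + d) * d)     ≡⟨ cong (ι Rl 6 * k *_) 2q≡[1+d]d ⟨
        ι Rl 6 * k * (ι Rl 2 * q)       ≡⟨ solve 2 (λ k q → ι̂ 6 :* k :* (ι̂ 2 :* q) := ι̂ 4 :* (k :* (ι̂ 3 :* q))) refl k q ⟩
        ι Rl 4 * (k * (ι Rl 3 * q))     ∎

    IsNonzeroMultiple⇒X≡0×Y≡0 : ∀ {a b c} →
      IsNonzeroMultiple ((1ℝ + d) * q) (ι Rl 3 * q) (ι Rl 6 * (1ℝ + d)) a b c → X d a b ≡ 0ℝ × Y d b c ≡ 0ℝ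
    IsNonzeroMultiple⇒X≡0×Y≡0 (k , _ , refl , refl , refl) = X-at-multiple k , Y-at-multiple k

    module _ (0<1+d : 0ℝ < 1ℝ + d) where

      Rform≡0⇔X≡0×Y≡0 : ∀ a b c → Rform d q a b c ≡ 0ℝ ⇔ (X d a b ≡ 0ℝ × Y d b c ≡ 0ℝ)
      Rform≡0⇔X≡0×Y≡0 a b c = begin
        Rform d q a b c ≡ 0ℝ
          ≈⟨ k*x≡0⇔x≡0 (ι[1+k]≢0 1) ⟨
        ι Rl 2 * Rform d q a b c ≡ 0ℝ
          ≡⟨ cong (_≡ 0ℝ) (2Rform≡2X²+[1+d]Y² a b c) ⟩
        ι Rl 2 * (X d a b * X d a b) + (1ℝ + d) * (Y d b c * Y d b c) ≡ 0ℝ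
          ≈⟨ u*x²+v*y²≡0⇔x≡0×y≡0 (0<ι[1+k] 1) 0<1+d ⟩
        (X d a b ≡ 0ℝ × Y d b c ≡ 0ℝ) ∎
        where open import Relation.Binary.Reasoning.Setoid (⇔-setoid 0ℓ)

      X≡0×Y≡0⇒IsNonzeroMultiple : ∀ {a b c} → NonzeroTriple Rl a b c → X d a b ≡ 0ℝ × Y d b c ≡ 0ℝ →
        IsNonzeroMultiple ((1ℝ + d) * q) (ι Rl 3 * q) (ι Rl 6 * (1ℝ + d)) a b c
      X≡0×Y≡0⇒IsNonzeroMultiple {a} {b} {c} nonzero (X≡0 , Y≡0) = k , k≢0 , a≡kα , b≡-kβ , c≡kγ
        where
        open ≡-Reasoning
        α β γ : ℝ
        α = (1ℝ + d) * q
        β = ι Rl 3 * q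
        γ = ι Rl 6 * (1ℝ + d)
        3a≡-[1+d]b : ι Rl 3 * a ≡ - ((1ℝ + d) * b)
        3a≡-[1+d]b = Equivalence.to x+y≡0⇔x≡-y X≡0
        4b≡-dc : ι Rl 4 * b ≡ - (d * c)
        4b≡-dc = Equivalence.to x+y≡0⇔x≡-y Y≡0
        c≢0 : ¬ (c ≡ 0ℝ)
        c≢0 c≡0 = nonzero (a≡0 , b≡0 , c≡0)
          where
          b≡0 : b ≡ 0ℝ
          b≡0 = Equivalence.to (k*x≡0⇔x≡0 (ι[1+k]≢0 3)) (trans 4b≡-dc (y≡0⇒-[x*y]≡0 c≡0))
          a≡0 : a ≡ 0ℝ
          a≡0 = Equivalence.to (k*x≡0⇔x≡0 (ι[1+k]≢0 2)) (trans 3a≡-[1+d]b (y≡0⇒-[x*y]≡0 b≡0))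
        γ≢0 : ¬ (γ ≡ 0ℝ)
        γ≢0 = 0<x⇒x≢0 (*-pos (0<ι[1+k] 5) 0<1+d)
        k : ℝ
        k = c * inv γ γ≢0
        c≡kγ : c ≡ k * γ
        c≡kγ = x≡[x*inv[s]]*s γ≢0 c
        k≢0 : ¬ (k ≡ 0ℝ)
        k≢0 k≡0 = c≢0 (trans c≡kγ (trans (cong (_* γ) k≡0) (zeroˡ γ)))
        b≡-kβ : b ≡ - (k * β)
        b≡-kβ = *-cancelˡ (ι[1+k]≢0 3) (begin
          ι Rl 4 * b                 ≡⟨ 4b≡-dc ⟩
          - (d * c)                  ≡⟨ cong (λ t → - (d * t)) c≡kγ ⟩
          - (d * (k * γ))            ≡⟨ Equivalence.to x+y≡0⇔x≡-y (Y-at-multiple k) ⟨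
          ι Rl 4 * - (k * β)         ∎)
        a≡kα : a ≡ k * α
        a≡kα = *-cancelˡ (ι[1+k]≢0 2) (begin
          ι Rl 3 * a                 ≡⟨ 3a≡-[1+d]b ⟩
          - ((1ℝ + d) * b)           ≡⟨ cong (λ t → - ((1ℝ + d) * t)) b≡-kβ ⟩
          - ((1ℝ + d) * - (k * β))   ≡⟨ Equivalence.to x+y≡0⇔x≡-y (X-at-multiple k) ⟨
          ι Rl 3 * (k * α)           ∎)

      X≡0×Y≡0⇔IsNonzeroMultiple : ∀ {a b c} → NonzeroTriple Rl a b c →
        (X d a b ≡ 0ℝ × Y d b c ≡ 0ℝ) ⇔ IsNonzeroMultiple ((1ℝ + d) * q) (ι Rl 3 * q) (ι Rl 6 * (1ℝ + d)) a b c
      X≡0×Y≡0⇔IsNonzeroMultiple nonzero = mk⇔ (X≡0×Y≡0⇒IsNonzeroMultiple nonzero) IsNonzeroMultiple⇒X≡0×Y≡0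

mainTheorem15 : (Rl : RealField) (n : ℕ) → 2 ≤ n →
    (a b c : RealField.ℝ Rl) → NonzeroTriple Rl a b c →
    (Rpoly Rl n a b c ≡ RealField.0ℝ Rl) ⇔ IsSpecialPoint Rl n a b c
mainTheorem15 Rl (suc (suc p)) (s≤s (s≤s z≤n)) a b c nonzero = begin
  Rpoly Rl (suc (suc p)) a b c ≡ 0ℝ                  ≡⟨ cong (_≡ 0ℝ) (Rpoly≡Rform p a b c) ⟩
  Rform d q a b c ≡ 0ℝ                               ≈⟨ Rform≡0⇔X≡0×Y≡0 2q≡[1+d]d 0<1+d a b c ⟩
  (X d a b ≡ 0ℝ × Y d b c ≡ 0ℝ)                      ≈⟨ X≡0×Y≡0⇔IsNonzeroMultiple 2q≡[1+d]d 0<1+d nonzero ⟩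
  IsNonzeroMultiple ((1ℝ + d) * q) (ι Rl 3 * q) (ι Rl 6 * (1ℝ + d)) a b c
                                                     ≡⟨ IsSpecialPoint≡IsNonzeroMultiple p a b c ⟨
  IsSpecialPoint Rl (suc (suc p)) a b c              ∎
  where
  open RealField Rl using (ℝ; 0ℝ; 1ℝ; _+_; _*_; _<_)
  open Quadric Rl
  open import Relation.Binary.Reasoning.Setoid (⇔-setoid 0ℓ)
  d q : ℝ
  d = ι Rl p
  q = ι Rl (suc p C 2)
  2q≡[1+d]d : ι Rl 2 * q ≡ (1ℝ + d) * d
  2q≡[1+d]d = ι2*ι[[1+p]C2]≡ι[1+p]*ι[p] p
  0<1+d : 0ℝ < 1ℝ + d
  0<1+d = 0<ι[1+k] p
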